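{- Let $G$ be a connected graph and $g\ge 0$ an integer. If $\kappa^g(G)$ exists, then $c^g(G)\ge \kappa^g(G)+g+1$. Moreover, equality holds if and only if there exists a $g$-good-neighbor cut $X$ with $|X|=\kappa^g(G)$ such that one of the connected components of $G-X$ is either a complete graph $K_{g+1}$, or is obtained from two disjoint copies of $K_{g+1}$ by adding at least one edge between them.
   Context: For a graph $G=(V,E)$, a set $X\subseteq V$ is a $g$-good-neighbor cut if $G-X$ is disconnected and every vertex of $V\setminus X$ has at least $g$ neighbors in $V\setminus X$; $\kappa^g(G)$ is the minimum size of such a cut, and it exists if such a cut exists. gc number: for a $g$-good-neighbor cut $X$ and a connected component $C$ of $G-X$, call $C$ splittable if $V(C)$ can be partitioned into two nonempty sets $A,B$ with $\delta(G[A])\ge g$ and $\delta(G[B])\ge g$; among such partitions with $|A|\ge|B|$ take one minimizing $|A|-|B|$ and set $a(C)=|A|$. Let $a(X)$ be the minimum of $a(C)$ over splittable components $C$ of $G-X$, and $c(X)$ the minimum number of vertices of a non-splittable component of $G-X$ (each minimum is $+\infty$ if taken over the empty set). The $g$-good neighbour cut-component number is $c^g(G)=\min\{|X|+\min\{a(X),c(X)\}\}$, the minimum over all $g$-good-neighbor cuts $X$ of $G$. -}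

module Defs where

open import Data.Nat using (ℕ; _+_; _∸_; _≤_; suc)
open import Data.Fin using (Fin)
open import Data.Bool using (Bool; true; false; if_then_else_)
open import Data.Fin.Subset using (Subset; Side; inside; outside; _∈_; _∉_; _⊆_; ∁; _∩_; ∣_∣)
open import Data.Vec using (tabulate)
open import Data.Product using (Σ; ∃; _×_; _,_)
open import Data.Sum using (_⊎_)
open import Data.Empty using (⊥)
open import Relation.Nullary using (¬_)
open import Relation.Binary.PropositionalEquality using (_≡_; _≢_)

record Graph (n : ℕ) : Set where
  field
    adj   : Fin n → Fin n → Bool
    sym   : ∀ u v → adj u v ≡ adj v u
    irrefl : ∀ v → adj v v ≡ false
open Graph public

module _ {n : ℕ} (G : Graph n) where

  Adj : Fin n → Fin n → Set
  Adj u v = adj G u v ≡ true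

  N : Fin n → Subset n
  N v = tabulate (λ w → if adj G v w then inside else outside)

  degIn : Fin n → Subset n → ℕ
  degIn v S = ∣ N v ∩ S ∣

  data Walk (S : Subset n) : Fin n → Fin n → Set where
    here : ∀ {u} → u ∈ S → Walk S u u
    step : ∀ {u w v} → u ∈ S → Adj u w → Walk S w v → Walk S u v

  Connected : Subset n → Set
  Connected S = (∃ λ v → v ∈ S) × (∀ u v → u ∈ S → v ∈ S → Walk S u v)

  ConnectedGraph : Set
  ConnectedGraph = Connected (∁ Data.Fin.Subset.⊥)

  MinDeg≥ : Subset n → ℕ → Set
  MinDeg≥ S g = ∀ v → v ∈ S → g ≤ degIn v S

  DisconnectedMinus : Subset n → Set
  DisconnectedMinus X = ∃ λ u → ∃ λ v → u ∉ X × v ∉ X × ¬ Walk (∁ X) u v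

  GoodNeighborCut : ℕ → Subset n → Set
  GoodNeighborCut g X = DisconnectedMinus X × MinDeg≥ (∁ X) g

  IsKappa : ℕ → ℕ → Set
  IsKappa g k = (∃ λ X → GoodNeighborCut g X × ∣ X ∣ ≡ k)
              × (∀ X → GoodNeighborCut g X → k ≤ ∣ X ∣)

  IsComponent : Subset n → Subset n → Set
  IsComponent X C = C ⊆ ∁ X × Connected C
                  × (∀ D → C ⊆ D → D ⊆ ∁ X → Connected D → D ⊆ C)

  GoodPartition : ℕ → Subset n → Subset n → Subset n → Set
  GoodPartition g C A B =
      (∃ λ v → v ∈ A) × (∃ λ v → v ∈ B)
    × (∀ v → v ∈ A → v ∈ B → ⊥)
    × (∀ v → v ∈ C → v ∈ A ⊎ v ∈ B)
    × (∀ v → v ∈ A ⊎ v ∈ B → v ∈ C)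
    × MinDeg≥ A g × MinDeg≥ B g

  Splittable : ℕ → Subset n → Set
  Splittable g C = ∃ λ A → ∃ λ B → GoodPartition g C A B

  IsA : ℕ → Subset n → ℕ → Set
  IsA g C a = (∃ λ A → ∃ λ B → GoodPartition g C A B × ∣ B ∣ ≤ ∣ A ∣ × ∣ A ∣ ≡ a
                 × (∀ A' B' → GoodPartition g C A' B' → ∣ B' ∣ ≤ ∣ A' ∣
                      → ∣ A ∣ ∸ ∣ B ∣ ≤ ∣ A' ∣ ∸ ∣ B' ∣))

  -- contribution of a component C of G - X to min{a(X), c(X)}:
  -- a(C) if C is splittable, |C| otherwise
  CompVal : ℕ → Subset n → Subset n → ℕ → Set
  CompVal g X C m = IsComponent X C
                  × ((Splittable g C × IsA g C m) ⊎ (¬ Splittable g C × m ≡ ∣ C ∣))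

  IsMinAC : ℕ → Subset n → ℕ → Set
  IsMinAC g X m = (∃ λ C → CompVal g X C m)
                × (∀ C m' → CompVal g X C m' → m ≤ m')

  IsCg : ℕ → ℕ → Set
  IsCg g c = (∃ λ X → GoodNeighborCut g X × ∃ λ m → IsMinAC g X m × c ≡ ∣ X ∣ + m)
           × (∀ X → GoodNeighborCut g X → ∀ m → IsMinAC g X m → c ≤ ∣ X ∣ + m)

  Clique : Subset n → Set
  Clique S = ∀ u v → u ∈ S → v ∈ S → u ≢ v → Adj u v

  IsKg+1 : ℕ → Subset n → Set
  IsKg+1 g C = ∣ C ∣ ≡ suc g × Clique C

  IsTwoKg+1 : ℕ → Subset n → Set
  IsTwoKg+1 g C = ∃ λ A → ∃ λ B →
      (∀ v → v ∈ A → v ∈ B → ⊥)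
    × (∀ v → v ∈ C → v ∈ A ⊎ v ∈ B)
    × (∀ v → v ∈ A ⊎ v ∈ B → v ∈ C)
    × IsKg+1 g A × IsKg+1 g B
    × (∃ λ u → ∃ λ v → u ∈ A × v ∈ B × Adj u v)

{-# OPTIONS --safe #-}
module Submission where

-- Every vertex outside a g-good-neighbor cut X has at least g neighbours
-- outside X, so every component of G - X, and every part of a good
-- partition of one, has at least g + 1 vertices. Hence |X| + min{a(X), c(X)}
-- is at least κ^g + g + 1, with equality only if |X| = κ^g and some component
-- either has exactly g + 1 vertices or splits into two parts of exactly g + 1
-- vertices. A set of g + 1 vertices with minimum degree g is a clique, and the
-- component is connected, so it is K_{g+1} or two copies of K_{g+1} joined by
-- an edge. Conversely such a component has value g + 1. All minima exist
-- because every predicate involved is decidable over the finitely many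
-- vertex subsets.

open import Defs
open import Data.Bool using (true; false; if_then_else_) renaming (_≟_ to _≟ᵇ_)
open import Data.Fin using (Fin) renaming (_≟_ to _≟ᶠ_)
open import Data.Fin.Properties using (any?; all?)
open import Data.Fin.Subset
  using (Subset; Side; inside; outside; _∈_; _∉_; _⊆_; ∁; _∩_; _∪_; _-_; ⁅_⁆; ∣_∣; Nonempty)
open import Data.Fin.Subset.Properties
  using ( _∈?_; _⊆?_; nonempty?; anySubset?; Empty-unique; ∣⊥∣≡0; ∣p∣≤∣x∷p∣; ∣⁅x⁆∣≡1
        ; p⊆q⇒∣p∣≤∣q∣; x∈p⇒∣p-x∣<∣p∣; x∈⁅x⁆; x∈⁅y⁆⇒x≡y; x∉p⇒x∈∁p; x∈p∧x≢y⇒x∈p-y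
        ; x∈p∩q⁺; x∈p∩q⁻; x∈p∪q⁺; x∈p∪q⁻; p⊆p∪q; q⊆p∪q; p─q⊆p)
open import Data.Nat using (ℕ; zero; suc; _+_; _∸_; _≤_; _<_; z≤n; s≤s; _≤?_; _≟_)
open import Data.Nat.Induction using (<-wellFounded)
open import Data.Nat.Properties
  using ( ≤-trans; ≤-pred; ≤-reflexive; ≤-antisym; <-irrefl; <⇒≤; <⇒≢; ≰⇒>; m≤n+m; n∸n≡0
        ; +-suc; +-comm; +-assoc; +-monoʳ-≤; +-mono-≤; +-cancelʳ-≤; +-cancelˡ-≤; +-cancelˡ-≡
        ; anyUpTo?; module ≤-Reasoning)
open import Data.Product using (∃; ∃₂; _×_; _,_; proj₁; proj₂)
open import Data.Sum using (_⊎_; inj₁; inj₂; [_,_]′; swap)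
open import Data.Vec using (_∷_; []; tabulate)
open import Data.Vec.Properties using ([]=⇒lookup; lookup⇒[]=; lookup∘tabulate)
open import Function using (_∘_; id)
open import Function.Bundles using (_⇔_; mk⇔)
open import Induction.WellFounded using (Acc; acc)
open import Relation.Nullary
  using (¬_; Dec; yes; no; does; ¬?; _×-dec_; _⊎-dec_; _→-dec_; map′; decidable-stable; contradiction)
open import Relation.Nullary.Decidable using (dec-true)
open import Relation.Unary using (Pred; Decidable)
open import Relation.Binary.PropositionalEquality as ≡ using (_≡_; _≢_; refl; cong; subst)

open ≤-Reasoning

least : ∀ {ℓ} {P : Pred ℕ ℓ} → Decidable P → ∀ {s} → P s → ∃ λ d → P d × (∀ e → P e → d ≤ e)
least P? {zero} p₀ = 0 , p₀ , λ _ _ → z≤n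
least {P = P} P? {suc s} p with P? 0
... | yes p₀ = 0 , p₀ , λ _ _ → z≤n
... | no ¬p₀ with least (P? ∘ suc) p
...   | d , pd , minimal = suc d , pd , above
  where
  above : ∀ e → P e → suc d ≤ e
  above zero    p₀ = contradiction p₀ ¬p₀
  above (suc e) pe = s≤s (minimal e pe)

∃-bounded? : ∀ {ℓ} {P : Pred ℕ ℓ} → Decidable P → ∀ c → (∀ {m} → P m → m ≤ c) → Dec (∃ P)
∃-bounded? P? c bounded =
  map′ (λ (m , _ , pm) → m , pm) (λ (m , pm) → m , s≤s (bounded pm) , pm) (anyUpTo? P? (suc c))

+-mono-≤-tight : ∀ {a b x y} → a ≤ x → b ≤ y → x + y ≡ a + b → x ≡ a × y ≡ b
+-mono-≤-tight {a} {b} {x} {y} a≤x b≤y x+y≡a+b =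
  x≡a , +-cancelˡ-≡ a y b (≡.trans (cong (_+ y) (≡.sym x≡a)) x+y≡a+b)
  where
  x≡a : x ≡ a
  x≡a = ≤-antisym (+-cancelʳ-≤ b x a (begin
    x + b  ≤⟨ +-monoʳ-≤ x b≤y ⟩
    x + y  ≡⟨ x+y≡a+b ⟩
    a + b  ∎)) a≤x

m+n+1≡m+suc[n] : ∀ m n → m + n + 1 ≡ m + suc n
m+n+1≡m+suc[n] m n = ≡.trans (+-assoc m n 1) (cong (m +_) (+-comm n 1))

allSubset? : ∀ {n ℓ} {P : Pred (Subset n) ℓ} → Decidable P → Dec (∀ S → P S)
allSubset? P? with anySubset? (¬? ∘ P?)
... | yes (S , ¬PS) = no λ ∀P → ¬PS (∀P S)
... | no ∄¬P        = yes λ S → decidable-stable (P? S) λ ¬PS → ∄¬P (S , ¬PS)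

∣p∪q∣≤∣p∣+∣q∣ : ∀ {n} (p q : Subset n) → ∣ p ∪ q ∣ ≤ ∣ p ∣ + ∣ q ∣
∣p∪q∣≤∣p∣+∣q∣ []            []            = z≤n
∣p∪q∣≤∣p∣+∣q∣ (inside ∷ p)  (s ∷ q)       =
  s≤s (≤-trans (∣p∪q∣≤∣p∣+∣q∣ p q) (+-monoʳ-≤ ∣ p ∣ (∣p∣≤∣x∷p∣ s q)))
∣p∪q∣≤∣p∣+∣q∣ (outside ∷ p) (inside ∷ q)  =
  ≤-trans (s≤s (∣p∪q∣≤∣p∣+∣q∣ p q)) (≤-reflexive (≡.sym (+-suc ∣ p ∣ ∣ q ∣)))
∣p∪q∣≤∣p∣+∣q∣ (outside ∷ p) (outside ∷ q) = ∣p∪q∣≤∣p∣+∣q∣ p q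

0<∣p∣⇒Nonempty : ∀ {n} {p : Subset n} → 0 < ∣ p ∣ → Nonempty p
0<∣p∣⇒Nonempty {n} {p} 0<∣p∣ = decidable-stable (nonempty? p) λ p-empty →
  <⇒≢ 0<∣p∣ (≡.sym (≡.trans (cong ∣_∣ (Empty-unique p-empty)) (∣⊥∣≡0 n)))

∈-tabulate⁻ : ∀ {n} {f : Fin n → Side} {x} → x ∈ tabulate f → f x ≡ inside
∈-tabulate⁻ {f = f} {x} x∈ = ≡.trans (≡.sym (lookup∘tabulate f x)) ([]=⇒lookup x∈)

∈-tabulate⁺ : ∀ {n} {f : Fin n → Side} {x} → f x ≡ inside → x ∈ tabulate f
∈-tabulate⁺ {f = f} {x} fx = lookup⇒[]= x (tabulate f) (≡.trans (lookup∘tabulate f x) fx)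

module _ {n ℓ} {P : Pred (Fin n) ℓ} (P? : Decidable P) where

  subset : Subset n
  subset = tabulate (does ∘ P?)

  ∈-subset⁺ : ∀ {x} → P x → x ∈ subset
  ∈-subset⁺ {x} px = ∈-tabulate⁺ (dec-true (P? x) px)

  ∈-subset⁻ : ∀ {x} → x ∈ subset → P x
  ∈-subset⁻ {x} x∈ with P? x | ∈-tabulate⁻ {f = does ∘ P?} x∈
  ... | yes px | _ = px
  ... | no _   | ()

module _ {n} (G : Graph n) where

  private variable
    S T A B C X : Subset n
    u v w x a b : Fin n

  ∈N⇒Adj : x ∈ N G v → Adj G v x
  ∈N⇒Adj {x} {v} x∈ with adj G v x | ∈-tabulate⁻ x∈
  ... | true  | _ = refl
  ... | false | ()

  Adj⇒∈N : Adj G v x → x ∈ N G v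
  Adj⇒∈N v~x = ∈-tabulate⁺ (cong (λ e → if e then inside else outside) v~x)

  v∉N[v] : ∀ v → v ∉ N G v
  v∉N[v] v v∈ with ≡.trans (≡.sym (∈N⇒Adj v∈)) (irrefl G v)
  ... | ()

  Adj-sym : Adj G u v → Adj G v u
  Adj-sym {u} {v} u~v = ≡.trans (sym G v u) u~v

  walk-start : Walk G S u v → u ∈ S
  walk-start (here u∈) = u∈
  walk-start (step u∈ _ _) = u∈

  walk-end : Walk G S u v → v ∈ S
  walk-end (here v∈) = v∈
  walk-end (step _ _ W) = walk-end W

  walk-mono : S ⊆ T → Walk G S u v → Walk G T u v
  walk-mono S⊆T (here u∈) = here (S⊆T u∈)
  walk-mono S⊆T (step u∈ u~w W) = step (S⊆T u∈) u~w (walk-mono S⊆T W)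

  _++ʷ_ : Walk G S u v → Walk G S v w → Walk G S u w
  here _        ++ʷ W′ = W′
  step u∈ u~w W ++ʷ W′ = step u∈ u~w (W ++ʷ W′)

  walk-reverse : Walk G S u v → Walk G S v u
  walk-reverse (here u∈) = here u∈
  walk-reverse (step u∈ u~w W) = walk-reverse W ++ʷ step (walk-start W) (Adj-sym u~w) (here u∈)

  -- Either the walk avoids u, or it is cut at its last visit to u.
  walk-avoiding : u ≢ v → Walk G S x v → Walk G (S - u) x v ⊎ ∃ λ w → Adj G u w × Walk G (S - u) w v
  walk-avoiding u≢v (here v∈) = inj₁ (here (x∈p∧x≢y⇒x∈p-y v∈ (u≢v ∘ ≡.sym)))
  walk-avoiding {u = u} u≢v (step {u = x} {w = w} x∈ x~w W) with walk-avoiding u≢v W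
  ... | inj₂ later = inj₂ later
  ... | inj₁ W′ with x ≟ᶠ u
  ...   | yes refl = inj₂ (w , x~w , W′)
  ...   | no x≢u   = inj₁ (step (x∈p∧x≢y⇒x∈p-y x∈ x≢u) x~w W′)

  walk-first-step : u ≢ v → Walk G S u v → ∃ λ w → Adj G u w × Walk G (S - u) w v
  walk-first-step u≢v (here _)       = contradiction refl u≢v
  walk-first-step u≢v (step _ u~w W) = [ (λ W′ → _ , u~w , W′) , id ]′ (walk-avoiding u≢v W)

  walk? : ∀ S u v → Dec (Walk G S u v)
  walk? S = walk?′ S (<-wellFounded ∣ S ∣)
    where
    walk?′ : ∀ S → Acc _<_ ∣ S ∣ → ∀ u v → Dec (Walk G S u v)
    walk?′ S (acc smaller) u v with u ∈? S | u ≟ᶠ v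
    ... | no u∉S  | _        = no (u∉S ∘ walk-start)
    ... | yes u∈S | yes refl = yes (here u∈S)
    ... | yes u∈S | no u≢v   =
      map′ (λ (w , u~w , W) → step u∈S u~w (walk-mono (p─q⊆p S ⁅ u ⁆) W)) (walk-first-step u≢v)
        (any? λ w → (adj G u w ≟ᵇ true) ×-dec walk?′ (S - u) (smaller (x∈p⇒∣p-x∣<∣p∣ u∈S)) w v)

  walk-leaves : Walk G S a b → a ∈ A → b ∉ A → ∃₂ λ u w → u ∈ A × w ∉ A × w ∈ S × Adj G u w
  walk-leaves (here _) a∈A b∉A = contradiction a∈A b∉A
  walk-leaves {A = A} (step {u = a} {w = w} _ a~w W) a∈A b∉A with w ∈? A
  ... | yes w∈A = walk-leaves W w∈A b∉A
  ... | no w∉A  = a , w , a∈A , w∉A , walk-start W , a~w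

  rooted⇒Connected : v ∈ S → (∀ u → u ∈ S → Walk G S u v) → Connected G S
  rooted⇒Connected v∈S to-root =
    (_ , v∈S) , λ a b a∈ b∈ → to-root a a∈ ++ʷ walk-reverse (to-root b b∈)

  Connected-∪-neighbour : Connected G C → v ∈ C → Adj G v w → Connected G (C ∪ ⁅ w ⁆)
  Connected-∪-neighbour {C = C} {v = v} {w = w} (_ , connected) v∈C v~w =
    rooted⇒Connected (p⊆p∪q ⁅ w ⁆ v∈C) to-v
    where
    to-v : ∀ u → u ∈ C ∪ ⁅ w ⁆ → Walk G (C ∪ ⁅ w ⁆) u v
    to-v u u∈ with x∈p∪q⁻ C ⁅ w ⁆ u∈
    ... | inj₁ u∈C = walk-mono (p⊆p∪q ⁅ w ⁆) (connected u v u∈C v∈C)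
    ... | inj₂ u∈⁅w⁆ with x∈⁅y⁆⇒x≡y w u∈⁅w⁆
    ...   | refl = step u∈ (Adj-sym v~w) (here (p⊆p∪q ⁅ w ⁆ v∈C))

  component-closed : IsComponent G X C → v ∈ C → w ∈ ∁ X → Adj G v w → w ∈ C
  component-closed {X = X} {C = C} {w = w} (C⊆∁X , connected , maximal) v∈C w∈∁X v~w =
    maximal (C ∪ ⁅ w ⁆) (p⊆p∪q ⁅ w ⁆) C∪⁅w⁆⊆∁X (Connected-∪-neighbour connected v∈C v~w)
      (q⊆p∪q C ⁅ w ⁆ (x∈⁅x⁆ w))
    where
    C∪⁅w⁆⊆∁X : C ∪ ⁅ w ⁆ ⊆ ∁ X
    C∪⁅w⁆⊆∁X x∈ with x∈p∪q⁻ C ⁅ w ⁆ x∈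
    ... | inj₁ x∈C   = C⊆∁X x∈C
    ... | inj₂ x∈⁅w⁆ = subst (_∈ ∁ X) (≡.sym (x∈⁅y⁆⇒x≡y w x∈⁅w⁆)) w∈∁X

  component-containing : u ∉ X → ∃ (IsComponent G X)
  component-containing {u = u} {X = X} u∉X =
    reach , (walk-end ∘ ∈-subset⁻ reachable?) , rooted⇒Connected u∈reach to-u , maximal
    where
    reachable? : Decidable (Walk G (∁ X) u)
    reachable? = walk? (∁ X) u
    reach : Subset n
    reach = subset reachable?
    u∈∁X : u ∈ ∁ X
    u∈∁X = x∉p⇒x∈∁p u∉X
    u∈reach : u ∈ reach
    u∈reach = ∈-subset⁺ reachable? (here u∈∁X)
    lift : ∀ {a b} → Walk G (∁ X) u a → Walk G (∁ X) a b → Walk G reach a b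
    lift u⇝a (here _) = here (∈-subset⁺ reachable? u⇝a)
    lift u⇝a (step a∈ a~w w⇝b) =
      step (∈-subset⁺ reachable? u⇝a) a~w (lift (u⇝a ++ʷ step a∈ a~w (here (walk-start w⇝b))) w⇝b)
    to-u : ∀ b → b ∈ reach → Walk G reach b u
    to-u b b∈reach = walk-reverse (lift (here u∈∁X) (∈-subset⁻ reachable? b∈reach))
    maximal : ∀ D → reach ⊆ D → D ⊆ ∁ X → Connected G D → D ⊆ reach
    maximal D reach⊆D D⊆∁X (_ , connected) x∈D =
      ∈-subset⁺ reachable? (walk-mono D⊆∁X (connected u _ (reach⊆D u∈reach) x∈D))

  connected? : Decidable (Connected G)
  connected? S = nonempty? S ×-dec all? λ u → all? λ v → u ∈? S →-dec v ∈? S →-dec walk? S u v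

  isComponent? : ∀ X → Decidable (IsComponent G X)
  isComponent? X C = C ⊆? ∁ X ×-dec connected? C ×-dec
    allSubset? λ D → C ⊆? D →-dec D ⊆? ∁ X →-dec connected? D →-dec D ⊆? C

  module _ (g : ℕ) where

    private variable
      k c m : ℕ

    N∩S⊆S-v : ∀ v → N G v ∩ S ⊆ S - v
    N∩S⊆S-v {S = S} v x∈ with x∈p∩q⁻ (N G v) S x∈
    ... | x∈N , x∈S = x∈p∧x≢y⇒x∈p-y x∈S λ { refl → v∉N[v] v x∈N }

    MinDeg≥⇒size : MinDeg≥ G S g → v ∈ S → suc g ≤ ∣ S ∣
    MinDeg≥⇒size {S = S} {v = v} δ≥g v∈S = begin-strict
      g                ≤⟨ δ≥g v v∈S ⟩
      ∣ N G v ∩ S ∣    ≤⟨ p⊆q⇒∣p∣≤∣q∣ (N∩S⊆S-v v) ⟩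
      ∣ S - v ∣        <⟨ x∈p⇒∣p-x∣<∣p∣ v∈S ⟩
      ∣ S ∣            ∎

    MinDeg≥⇒Clique : MinDeg≥ G S g → ∣ S ∣ ≡ suc g → Clique G S
    MinDeg≥⇒Clique {S = S} δ≥g ∣S∣≡1+g u v u∈S v∈S u≢v =
      decidable-stable (adj G u v ≟ᵇ true) non-adjacency-impossible
      where
      v∈S-u : v ∈ S - u
      v∈S-u = x∈p∧x≢y⇒x∈p-y v∈S (u≢v ∘ ≡.sym)
      non-adjacency-impossible : ¬ ¬ Adj G u v
      non-adjacency-impossible u≁v = <-irrefl refl (begin-strict
        suc g                 ≤⟨ s≤s (δ≥g u u∈S) ⟩
        suc ∣ N G u ∩ S ∣     ≤⟨ s≤s (p⊆q⇒∣p∣≤∣q∣ N∩S⊆S-u-v) ⟩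
        suc ∣ S - u - v ∣     ≤⟨ x∈p⇒∣p-x∣<∣p∣ v∈S-u ⟩
        ∣ S - u ∣             <⟨ x∈p⇒∣p-x∣<∣p∣ u∈S ⟩
        ∣ S ∣                 ≡⟨ ∣S∣≡1+g ⟩
        suc g                 ∎)
        where
        N∩S⊆S-u-v : N G u ∩ S ⊆ S - u - v
        N∩S⊆S-u-v x∈ = x∈p∧x≢y⇒x∈p-y (N∩S⊆S-v u x∈)
          λ { refl → u≁v (∈N⇒Adj (proj₁ (x∈p∩q⁻ (N G u) S x∈))) }

    Kg+1⇒MinDeg≥ : IsKg+1 G g S → MinDeg≥ G S g
    Kg+1⇒MinDeg≥ {S = S} (∣S∣≡1+g , clique) v v∈S = ≤-pred (begin
      suc g                         ≡⟨ ≡.sym ∣S∣≡1+g ⟩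
      ∣ S ∣                         ≤⟨ p⊆q⇒∣p∣≤∣q∣ S⊆⁅v⁆∪N∩S ⟩
      ∣ ⁅ v ⁆ ∪ (N G v ∩ S) ∣       ≤⟨ ∣p∪q∣≤∣p∣+∣q∣ ⁅ v ⁆ (N G v ∩ S) ⟩
      ∣ ⁅ v ⁆ ∣ + ∣ N G v ∩ S ∣     ≡⟨ cong (_+ ∣ N G v ∩ S ∣) (∣⁅x⁆∣≡1 v) ⟩
      suc ∣ N G v ∩ S ∣             ∎)
      where
      S⊆⁅v⁆∪N∩S : S ⊆ ⁅ v ⁆ ∪ (N G v ∩ S)
      S⊆⁅v⁆∪N∩S {x} x∈S with x ≟ᶠ v
      ... | yes refl = x∈p∪q⁺ (inj₁ (x∈⁅x⁆ x))
      ... | no x≢v   = x∈p∪q⁺ (inj₂ (x∈p∩q⁺ (Adj⇒∈N (clique v x v∈S x∈S (x≢v ∘ ≡.sym)) , x∈S)))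

    component-MinDeg≥ : IsComponent G X C → MinDeg≥ G (∁ X) g → MinDeg≥ G C g
    component-MinDeg≥ {X = X} {C = C} comp δ≥g v v∈C =
      ≤-trans (δ≥g v (proj₁ comp v∈C)) (p⊆q⇒∣p∣≤∣q∣ N∩∁X⊆N∩C)
      where
      N∩∁X⊆N∩C : N G v ∩ ∁ X ⊆ N G v ∩ C
      N∩∁X⊆N∩C x∈ with x∈p∩q⁻ (N G v) (∁ X) x∈
      ... | x∈N , x∈∁X = x∈p∩q⁺ (x∈N , component-closed comp v∈C x∈∁X (∈N⇒Adj x∈N))

    MinDeg≥? : Decidable (λ S → MinDeg≥ G S g)
    MinDeg≥? S = all? λ v → v ∈? S →-dec g ≤? degIn G v S

    goodNeighborCut? : Decidable (GoodNeighborCut G g)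
    goodNeighborCut? X = disconnected? ×-dec MinDeg≥? (∁ X)
      where
      disconnected? : Dec (DisconnectedMinus G X)
      disconnected? = any? λ u → any? λ v →
        ¬? (u ∈? X) ×-dec ¬? (v ∈? X) ×-dec ¬? (walk? (∁ X) u v)

    goodPartition? : ∀ C A B → Dec (GoodPartition G g C A B)
    goodPartition? C A B = nonempty? A ×-dec nonempty? B
      ×-dec all? (λ v → v ∈? A →-dec v ∈? B →-dec no λ ())
      ×-dec all? (λ v → v ∈? C →-dec (v ∈? A ⊎-dec v ∈? B))
      ×-dec all? (λ v → (v ∈? A ⊎-dec v ∈? B) →-dec v ∈? C)
      ×-dec MinDeg≥? A ×-dec MinDeg≥? B

    splittable? : Decidable (Splittable G g)
    splittable? C = anySubset? λ A → anySubset? λ B → goodPartition? C A B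

    isA? : ∀ C a → Dec (IsA G g C a)
    isA? C a = anySubset? λ A → anySubset? λ B →
      goodPartition? C A B ×-dec ∣ B ∣ ≤? ∣ A ∣ ×-dec ∣ A ∣ ≟ a ×-dec
      allSubset? λ A′ → allSubset? λ B′ →
        goodPartition? C A′ B′ →-dec ∣ B′ ∣ ≤? ∣ A′ ∣ →-dec ∣ A ∣ ∸ ∣ B ∣ ≤? ∣ A′ ∣ ∸ ∣ B′ ∣

    compVal? : ∀ X C m → Dec (CompVal G g X C m)
    compVal? X C m = isComponent? X C ×-dec
      (splittable? C ×-dec isA? C m ⊎-dec ¬? (splittable? C) ×-dec m ≟ ∣ C ∣)

    GoodPartition-swap : GoodPartition G g C A B → GoodPartition G g C B A
    GoodPartition-swap (A≢∅ , B≢∅ , disjoint , C⊆A∪B , A∪B⊆C , δA , δB) =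
      B≢∅ , A≢∅ , (λ v v∈B v∈A → disjoint v v∈A v∈B) , (λ v → swap ∘ C⊆A∪B v)
      , (λ v → A∪B⊆C v ∘ swap) , δB , δA

    Kg+1-unsplittable : IsKg+1 G g C → ¬ Splittable G g C
    Kg+1-unsplittable {C = C} (∣C∣≡1+g , _)
      (A , B , (_ , a∈A) , (b , b∈B) , disjoint , _ , A∪B⊆C , δA , _) = <-irrefl refl (begin-strict
        suc g      ≤⟨ MinDeg≥⇒size δA a∈A ⟩
        ∣ A ∣      ≤⟨ p⊆q⇒∣p∣≤∣q∣ A⊆C-b ⟩
        ∣ C - b ∣  <⟨ x∈p⇒∣p-x∣<∣p∣ (A∪B⊆C b (inj₂ b∈B)) ⟩
        ∣ C ∣      ≡⟨ ∣C∣≡1+g ⟩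
        suc g      ∎)
      where
      A⊆C-b : A ⊆ C - b
      A⊆C-b x∈A = x∈p∧x≢y⇒x∈p-y (A∪B⊆C _ (inj₁ x∈A)) λ { refl → disjoint b x∈A b∈B }

    CompVal-lower : MinDeg≥ G (∁ X) g → CompVal G g X C m → suc g ≤ m
    CompVal-lower _ (_ , inj₁ (_ , _ , _ , ((_ , a∈A) , _ , _ , _ , _ , δA , _) , _ , refl , _)) =
      MinDeg≥⇒size δA a∈A
    CompVal-lower δ≥g (comp@(_ , ((_ , c∈C) , _) , _) , inj₂ (_ , refl)) =
      MinDeg≥⇒size (component-MinDeg≥ comp δ≥g) c∈C

    small-CompVal : IsComponent G X C → IsKg+1 G g C ⊎ IsTwoKg+1 G g C → CompVal G g X C (suc g)
    small-CompVal comp (inj₁ K@(∣C∣≡1+g , _)) = comp , inj₂ (Kg+1-unsplittable K , ≡.sym ∣C∣≡1+g)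
    small-CompVal {C = C} comp
      (inj₂ (A , B , disjoint , C⊆A∪B , A∪B⊆C , KA@(∣A∣≡1+g , _) , KB@(∣B∣≡1+g , _) , _)) =
      comp , inj₁ ((A , B , partition) , A , B , partition , ∣B∣≤∣A∣ , ∣A∣≡1+g , balanced)
      where
      nonempty : ∀ {S} → ∣ S ∣ ≡ suc g → Nonempty S
      nonempty ∣S∣≡1+g = 0<∣p∣⇒Nonempty (subst (0 <_) (≡.sym ∣S∣≡1+g) (s≤s z≤n))
      partition : GoodPartition G g C A B
      partition = nonempty ∣A∣≡1+g , nonempty ∣B∣≡1+g , disjoint , C⊆A∪B , A∪B⊆C
                , Kg+1⇒MinDeg≥ KA , Kg+1⇒MinDeg≥ KB
      ∣B∣≤∣A∣ : ∣ B ∣ ≤ ∣ A ∣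
      ∣B∣≤∣A∣ = ≤-reflexive (≡.trans ∣B∣≡1+g (≡.sym ∣A∣≡1+g))
      balanced : ∀ A′ B′ → GoodPartition G g C A′ B′ → ∣ B′ ∣ ≤ ∣ A′ ∣ → ∣ A ∣ ∸ ∣ B ∣ ≤ ∣ A′ ∣ ∸ ∣ B′ ∣
      balanced _ _ _ _ rewrite ∣A∣≡1+g | ∣B∣≡1+g | n∸n≡0 g = z≤n

    CompVal-suc⇒small : MinDeg≥ G (∁ X) g → CompVal G g X C (suc g) → IsKg+1 G g C ⊎ IsTwoKg+1 G g C
    CompVal-suc⇒small δ≥g (comp , inj₂ (_ , 1+g≡∣C∣)) =
      inj₁ (≡.sym 1+g≡∣C∣ , MinDeg≥⇒Clique (component-MinDeg≥ comp δ≥g) (≡.sym 1+g≡∣C∣))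
    CompVal-suc⇒small {C = C} _ ((_ , (_ , connected) , _) , inj₁ (_ , A , B
      , ((a , a∈A) , (b , b∈B) , disjoint , C⊆A∪B , A∪B⊆C , δA , δB) , ∣B∣≤∣A∣ , ∣A∣≡1+g , _)) =
      inj₂ (A , B , disjoint , C⊆A∪B , A∪B⊆C , (∣A∣≡1+g , MinDeg≥⇒Clique δA ∣A∣≡1+g)
           , (∣B∣≡1+g , MinDeg≥⇒Clique δB ∣B∣≡1+g) , crossing-edge)
      where
      ∣B∣≡1+g : ∣ B ∣ ≡ suc g
      ∣B∣≡1+g = ≤-antisym (≤-trans ∣B∣≤∣A∣ (≤-reflexive ∣A∣≡1+g)) (MinDeg≥⇒size δB b∈B)
      crossing-edge : ∃₂ λ u v → u ∈ A × v ∈ B × Adj G u v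
      crossing-edge with walk-leaves (connected a b (A∪B⊆C a (inj₁ a∈A)) (A∪B⊆C b (inj₂ b∈B)))
                           a∈A (λ b∈A → disjoint b b∈A b∈B)
      ... | u , w , u∈A , w∉A , w∈C , u~w =
        u , w , u∈A , [ (λ w∈A → contradiction w∈A w∉A) , id ]′ (C⊆A∪B w w∈C) , u~w

    PartitionImbalance : Subset n → ℕ → Set
    PartitionImbalance C d =
      ∃₂ λ A B → GoodPartition G g C A B × ∣ B ∣ ≤ ∣ A ∣ × ∣ A ∣ ∸ ∣ B ∣ ≡ d

    partitionImbalance? : ∀ C → Decidable (PartitionImbalance C)
    partitionImbalance? C d = anySubset? λ A → anySubset? λ B →
      goodPartition? C A B ×-dec ∣ B ∣ ≤? ∣ A ∣ ×-dec ∣ A ∣ ∸ ∣ B ∣ ≟ d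

    oriented-partition : Splittable G g C → ∃ (PartitionImbalance C)
    oriented-partition (A , B , partition) with ∣ B ∣ ≤? ∣ A ∣
    ... | yes ∣B∣≤∣A∣ = _ , A , B , partition , ∣B∣≤∣A∣ , refl
    ... | no ∣B∣≰∣A∣  = _ , B , A , GoodPartition-swap partition , <⇒≤ (≰⇒> ∣B∣≰∣A∣) , refl

    IsA-exists : Splittable G g C → ∃ (IsA G g C)
    IsA-exists {C = C} split
      with least (partitionImbalance? C) (proj₂ (oriented-partition split))
    ... | _ , (A , B , partition , ∣B∣≤∣A∣ , refl) , minimal =
      ∣ A ∣ , A , B , partition , ∣B∣≤∣A∣ , refl ,
      λ A′ B′ partition′ ∣B′∣≤∣A′∣ → minimal _ (A′ , B′ , partition′ , ∣B′∣≤∣A′∣ , refl)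

    CompVal-exists : IsComponent G X C → ∃ (CompVal G g X C)
    CompVal-exists {C = C} comp with splittable? C
    ... | yes split = let a , isA = IsA-exists split in a , comp , inj₁ (split , isA)
    ... | no ¬split = ∣ C ∣ , comp , inj₂ (¬split , refl)

    IsMinAC-exists : GoodNeighborCut G g X → ∃ (IsMinAC G g X)
    IsMinAC-exists {X = X} ((_ , _ , u∉X , _) , _) =
      let C₀ , comp₀ = component-containing u∉X
          _ , value₀ = CompVal-exists comp₀
          m , attained , minimal = least (λ m → anySubset? λ C → compVal? X C m) (C₀ , value₀)
      in m , attained , λ C m′ value → minimal m′ (C , value)

    IsKappa-exists : ∃ (GoodNeighborCut G g) → ∃ (IsKappa G g)
    IsKappa-exists (X₀ , cut₀) =
      let k , attained , minimal =
            least (λ k → anySubset? λ X → goodNeighborCut? X ×-dec ∣ X ∣ ≟ k) (X₀ , cut₀ , refl)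
      in k , attained , λ X cut → minimal _ (X , cut , refl)

    -- Minimising |X| + m over all triples (X, C, m), rather than over minimal m only,
    -- gives the same minimum and avoids deciding IsMinAC.
    CutValue : ℕ → Set
    CutValue c = ∃ λ X → GoodNeighborCut G g X × ∃₂ λ C m → CompVal G g X C m × c ≡ ∣ X ∣ + m

    cutValue? : Decidable CutValue
    cutValue? c = anySubset? λ X → goodNeighborCut? X ×-dec anySubset? λ C →
      ∃-bounded? (λ m → compVal? X C m ×-dec c ≟ ∣ X ∣ + m) c
        λ {m} (_ , c≡X+m) → ≤-trans (m≤n+m m ∣ X ∣) (≤-reflexive (≡.sym c≡X+m))

    IsCg-exists : ∃ (GoodNeighborCut G g) → ∃ (IsCg G g)
    IsCg-exists (X₀ , cut₀) with IsMinAC-exists cut₀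
    ... | m₀ , (C₀ , value₀) , _
      with least cutValue? (X₀ , cut₀ , C₀ , m₀ , value₀ , refl)
    ... | c , (X , cut , C , m , value , c≡X+m) , minimal =
      c , (X , cut , m , ((C , value) , m-minimal) , c≡X+m) , c-minimal
      where
      m-minimal : ∀ C′ m′ → CompVal G g X C′ m′ → m ≤ m′
      m-minimal C′ m′ value′ = +-cancelˡ-≤ ∣ X ∣ m m′
        (subst (_≤ ∣ X ∣ + m′) c≡X+m (minimal _ (X , cut , C′ , m′ , value′ , refl)))
      c-minimal : ∀ X′ → GoodNeighborCut G g X′ → ∀ m′ → IsMinAC G g X′ m′ → c ≤ ∣ X′ ∣ + m′
      c-minimal X′ cut′ m′ ((C′ , value′) , _) = minimal _ (X′ , cut′ , C′ , m′ , value′ , refl)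

    Cg-lower : IsKappa G g k → IsCg G g c → k + g + 1 ≤ c
    Cg-lower {k} (_ , κ-minimal) ((X , cut , m , ((_ , value) , _) , refl) , _) = begin
      k + g + 1    ≡⟨ m+n+1≡m+suc[n] k g ⟩
      k + suc g    ≤⟨ +-mono-≤ (κ-minimal X cut) (CompVal-lower (proj₂ cut) value) ⟩
      ∣ X ∣ + m    ∎

    Cg-tight⇒small-component : IsKappa G g k → IsCg G g c → c ≡ k + g + 1
      → ∃ λ X → GoodNeighborCut G g X × ∣ X ∣ ≡ k
          × ∃ λ C → IsComponent G X C × (IsKg+1 G g C ⊎ IsTwoKg+1 G g C)
    Cg-tight⇒small-component {k} (_ , κ-minimal) ((X , cut , m , ((C , value) , _) , refl) , _) tight =
      X , cut , ∣X∣≡k , C , proj₁ value , CompVal-suc⇒small (proj₂ cut) (subst (CompVal G g X C) m≡1+g value)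
      where
      ∣X∣≡k×m≡1+g : ∣ X ∣ ≡ k × m ≡ suc g
      ∣X∣≡k×m≡1+g = +-mono-≤-tight (κ-minimal X cut) (CompVal-lower (proj₂ cut) value)
                      (≡.trans tight (m+n+1≡m+suc[n] k g))
      ∣X∣≡k = proj₁ ∣X∣≡k×m≡1+g
      m≡1+g = proj₂ ∣X∣≡k×m≡1+g

    small-component⇒Cg-tight : IsKappa G g k → IsCg G g c
      → (∃ λ X → GoodNeighborCut G g X × ∣ X ∣ ≡ k
           × ∃ λ C → IsComponent G X C × (IsKg+1 G g C ⊎ IsTwoKg+1 G g C))
      → c ≡ k + g + 1
    small-component⇒Cg-tight {c = c} κ cg@(_ , c-minimal) (X , cut , refl , C , comp , small)
      with IsMinAC-exists cut
    ... | m , minAC@(_ , m-minimal) = ≤-antisym (begin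
      c                ≤⟨ c-minimal X cut m minAC ⟩
      ∣ X ∣ + m        ≤⟨ +-monoʳ-≤ ∣ X ∣ (m-minimal C (suc g) (small-CompVal comp small)) ⟩
      ∣ X ∣ + suc g    ≡⟨ ≡.sym (m+n+1≡m+suc[n] ∣ X ∣ g) ⟩
      ∣ X ∣ + g + 1    ∎) (Cg-lower κ cg)

theorem3p1 : ∀ {n} (G : Graph n) (g : ℕ) → ConnectedGraph G
    → (∃ λ X → GoodNeighborCut G g X)
    → ∃ λ k → ∃ λ c → IsKappa G g k × IsCg G g c
        × (k + g + 1 ≤ c)
        × ((c ≡ k + g + 1) ⇔ (∃ λ X → GoodNeighborCut G g X × ∣ X ∣ ≡ k
             × ∃ λ C → IsComponent G X C × (IsKg+1 G g C ⊎ IsTwoKg+1 G g C)))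
theorem3p1 G g _ cut =
  let k , κ = IsKappa-exists G g cut
      c , cg = IsCg-exists G g cut
  in k , c , κ , cg , Cg-lower G g κ cg
   , mk⇔ (Cg-tight⇒small-component G g κ cg) (small-component⇒Cg-tight G g κ cg)
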